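{- Let $\Pi$ be a finite set of proposition symbols and $\Delta\in\mathbb{N}$. Given a message passing circuit (MPC) $C$ for $(\Pi,\Delta)$, one can construct a $\Pi$-program of $\mathrm{MSC}$ that is equivalent to $C$. Moreover, for any constant bound $c$ on the fan-in of MPCs (i.e. considering only MPCs all of whose gates have fan-in at most $c$), the size of the constructed program is linear in the size of the circuit. The computation time of the program is $\mathcal{O}(d+2^{|\Pi_1|})$ times the computation time of the MPC, where $d$ is the depth of $C$.
   Context: Proposition symbols: there is a countably infinite, linearly ordered set of proposition symbols partitioned into ordinary symbols and identifier symbols. For a finite set $\Pi$ of proposition symbols, $\Pi_0$ denotes its ordinary and $\Pi_1$ its identifier symbols. A Kripke model over $\Pi$ is $M=(W,R,V)$ with $W\neq\emptyset$, $R\subseteq W\times W$, $V:\Pi\to\mathcal P(W)$; $\mathrm{succ}(w)=\{v:(w,v)\in R\}$. If $p_1,\dots,p_\ell$ list $\Pi_1$ in order, $\mathrm{ID}(w)$ is the $\ell$-bit string whose $i$th bit is $1$ iff $w\in V(p_i)$; $M$ has identifiers if $\mathrm{ID}$ is injective. The local input of $w$ is the $|\Pi|$-bit string whose $i$th bit is $1$ iff $w$ satisfies the $i$th symbol of $\Pi$ (in the order). $\mathcal K(\Pi,\Delta)$ is the class of finite Kripke models over $\Pi$ with identifiers in which every node has out-degree at most $\Delta$. If the successors of $w$ have identifiers $s_1<\dots<s_d$ (lexicographic order), the successor with identifier $s_i$ is the $i$th neighbour of $w$. Acceptance of sequences: given a sequence $(\overline b_n)_{n\in\mathbb N}$ of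 $k$-bit strings and sets $A,P\subseteq[k]$ (attention and print positions), the sequence accepts in round $n$ if some position in $A$ of $\overline b_n$ is $1$ and all positions in $A$ of $\overline b_m$ are $0$ for all $m<n$; it then outputs the substring of $\overline b_n$ at the positions in $P$. Circuits: a Boolean circuit is a DAG whose nodes (gates) of nonzero in-degree are labelled $\wedge,\vee$ (any fan-in) or $\neg$ (fan-in 1); zero fan-in gates are input gates, zero fan-out gates are output gates, both linearly ordered; size = number of gates, depth = longest path length from an input to an output gate. A message passing circuit (MPC) for $(\Pi,\Delta)$ is a circuit computing a function $\{0,1\}^{|\Pi|+k(\Delta+1)}\to\{0,1\}^k$ (some $k$, the state length) together with sets $A,P\subseteq[k]$ of attention and print bits. On $M=(W,R,V)\in\mathcal K(\Pi,\Delta)$ it computes states $f_n(w)\in\{0,1\}^k$: $f_0(w)$ is the output of $C$ on $\overline t_w\cdot0^{k(\Delta+1)}$ where $\overline t_w$ is the local input; $f_{n+1}(w)$ is the output of $C$ on $\overline t_w\cdot f_n(w)\cdot f_n(v_1)\cdots f_n(v_m)\cdot(0^k)^{\Delta-m}$ where $v_1,\dots,v_m$ are the neighbours of $w$ in order. Node $w$ accepts/outputs in round $n$ if $(f_n(w))_n$ does so w.r.t. $(k,A,P)$; the round in which it outputs is the computation time at $w$. MSC: formulas of $\mathrm{ML}(\Pi)$ are given by $\varphi::=\top\mid p\mid\neg\varphi\mid(\varphi\wedge\varphi)\mid\Diamond\varphi$ ($p\in\Pi$), with the usual semantics ($\Diamond\varphi$ holds at $w$ iff $\varphi$ holds at some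 $v\in\mathrm{succ}(w)$). Schemata over a set $\mathcal T$ of schema variables additionally allow variables from $\mathcal T$. A $\Pi$-program of MSC has distinct head predicates (schema variables) $Y_1,\dots,Y_k$ (in a fixed order), for each $i$ a terminal clause $Y_i(0):=\varphi_i$ with $\varphi_i\in\mathrm{ML}(\Pi)$ and an iteration clause $Y_i:=\psi_i$ with $\psi_i$ a schema over $\{Y_1,\dots,Y_k\}$, and sets of attention and print predicates among the heads. Iteration formulas: $Y_i^0=\varphi_i$, and $Y_i^{n+1}$ is $\psi_i$ with every $Y_j$ replaced by $Y_j^n$. At node $w$ the round-$n$ configuration is the $k$-bit string whose $i$th bit is $1$ iff $(M,w)\models Y_i^n$; $w$ accepts/outputs in round $n$ if this sequence does so w.r.t. the positions of attention and print predicates; that round is the computation time. The size of a program is the number of occurrences of proposition symbols, head predicates, $\top,\neg,\wedge$ and diamonds. Equivalence: a program and an MPC $C$ for $(\Pi,\Delta)$ are equivalent if for every Kripke model $M\in\mathcal K(\Pi,\Delta)$ interpreting all proposition symbols of the program and every node $w$ of $M$, both produce the same output at $w$ or neither produces any output at $w$. -}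

module Defs where

open import Data.Bool using (Bool; true; false; _∧_; _∨_; not; if_then_else_; T)
open import Data.Nat using (ℕ; zero; suc; _+_; _*_; _≤_; _<_; _⊔_; _^_)
open import Data.Fin using (Fin; inject₁; fromℕ)
open import Data.List using (List; []; _∷_; length; map; filterᵇ; allFin; foldr; lookup)
open import Data.Bool.ListAction using (any; all)
open import Data.Nat.ListAction using (sum)
open import Data.List.NonEmpty using (List⁺; toList)
open import Data.List.Membership.Propositional using (_∈_)
open import Data.Vec using (Vec; []; _∷_; _∷ʳ_; _++_; replicate; concat; tabulate)
import Data.Vec as V
open import Data.Fin.Subset using (Subset)
open import Data.Product using (Σ; ∃; ∃-syntax; _×_; _,_)
open import Relation.Nullary using (¬_)
open import Relation.Binary.PropositionalEquality using (_≡_)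
open import Function.Definitions using (Injective)

-- Proposition symbols are the natural numbers (a countably infinite,
-- linearly ordered set).  The partition into ordinary / identifier
-- symbols is given by a predicate  isId : ℕ → Bool  (true = identifier).
-- A finite set Π of symbols is given as a strictly increasing list
-- (so position i in the list = i-th symbol of Π in the order).
-- Inside a model / formula the symbols of Π are referred to by their
-- position  Fin (length Π).

record Kripke (m : ℕ) : Set where
  field
    n : ℕ
    R : Fin (suc n) → Fin (suc n) → Bool
    V : Fin m → Fin (suc n) → Bool

module _ {m : ℕ} (M : Kripke m) where
  open Kripke M

  W : Set
  W = Fin (suc n)

  succs : W → List W
  succs w = filterᵇ (R w) (allFin (suc n))

  localInput : W → Vec Bool m
  localInput w = tabulate (λ i → V i w)

module _ (isId : ℕ → Bool) (Π : List ℕ) where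

  idPositions : List (Fin (length Π))
  idPositions = filterᵇ (λ i → isId (lookup Π i)) (allFin (length Π))

  numIds : ℕ
  numIds = length (filterᵇ isId Π)

  module _ (M : Kripke (length Π)) where
    open Kripke M

    ID : W M → List Bool
    ID w = map (λ i → V i w) idPositions

    HasIdentifiers : Set
    HasIdentifiers = Injective _≡_ _≡_ ID

    InClass : ℕ → Set
    InClass Δ = HasIdentifiers × (∀ w → length (succs M w) ≤ Δ)

lex≤ : List Bool → List Bool → Bool
lex≤ [] _ = true
lex≤ (_ ∷ _) [] = false
lex≤ (false ∷ xs) (false ∷ ys) = lex≤ xs ys
lex≤ (true ∷ xs) (true ∷ ys) = lex≤ xs ys
lex≤ (false ∷ _) (true ∷ _) = true
lex≤ (true ∷ _) (false ∷ _) = false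

insertBy : {A : Set} → (A → List Bool) → A → List A → List A
insertBy key a [] = a ∷ []
insertBy key a (b ∷ bs) = if lex≤ (key a) (key b) then a ∷ b ∷ bs else b ∷ insertBy key a bs

sortBy : {A : Set} → (A → List Bool) → List A → List A
sortBy key = foldr (insertBy key) []

neighbours : (isId : ℕ → Bool) (Π : List ℕ) (M : Kripke (length Π)) → W M → List (W M)
neighbours isId Π M w = sortBy (ID isId Π M) (succs M w)

select : {k : ℕ} → Subset k → Vec Bool k → List Bool
select [] [] = []
select (true ∷ P) (b ∷ bs) = b ∷ select P bs
select (false ∷ P) (b ∷ bs) = select P bs

someAttn : {k : ℕ} → Subset k → Vec Bool k → Bool
someAttn [] [] = false
someAttn (a ∷ A) (b ∷ bs) = (a ∧ b) ∨ someAttn A bs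

AcceptsAt : {k : ℕ} → Subset k → (ℕ → Vec Bool k) → ℕ → Set
AcceptsAt A s n = T (someAttn A (s n)) × (∀ j → j < n → someAttn A (s j) ≡ false)

OutputsAt : {k : ℕ} → Subset k → Subset k → (ℕ → Vec Bool k) → ℕ → List Bool → Set
OutputsAt A P s n o = AcceptsAt A s n × o ≡ select P (s n)

-- Gates are listed in a topological order; the first `inp` gates are the
-- input gates (in order); each further gate has a label and a nonempty
-- list of predecessors among the earlier gates.

data Gate (j : ℕ) : Set where
  AND : List⁺ (Fin j) → Gate j
  OR  : List⁺ (Fin j) → Gate j
  NOT : Fin j → Gate j

preds : {j : ℕ} → Gate j → List (Fin j)
preds (AND xs) = toList xs
preds (OR xs) = toList xs
preds (NOT x) = x ∷ []

fanIn : {j : ℕ} → Gate j → ℕ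
fanIn g = length (preds g)

data Gates (inp : ℕ) : ℕ → Set where
  inputs : Gates inp inp
  _▷_ : {j : ℕ} → Gates inp j → Gate j → Gates inp (suc j)

data Edge {inp : ℕ} : {j : ℕ} → Gates inp j → Fin j → Fin j → Set where
  here  : {j : ℕ} {gs : Gates inp j} {g : Gate j} {a : Fin j} →
          a ∈ preds g → Edge (gs ▷ g) (inject₁ a) (fromℕ j)
  there : {j : ℕ} {gs : Gates inp j} {g : Gate j} {a b : Fin j} →
          Edge gs a b → Edge (gs ▷ g) (inject₁ a) (inject₁ b)

gateVal : {j : ℕ} → Gate j → Vec Bool j → Bool
gateVal (AND xs) v = all (V.lookup v) (toList xs)
gateVal (OR xs) v = any (V.lookup v) (toList xs)
gateVal (NOT x) v = not (V.lookup v x)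

evalGates : {inp j : ℕ} → Gates inp j → Vec Bool inp → Vec Bool j
evalGates inputs x = x
evalGates (gs ▷ g) x = let v = evalGates gs x in v ∷ʳ gateVal g v

maxList : List ℕ → ℕ
maxList = foldr _⊔_ 0

gateDepths : {inp j : ℕ} → Gates inp j → Vec ℕ j
gateDepths {inp} inputs = replicate inp 0
gateDepths (gs ▷ g) = let d = gateDepths gs in d ∷ʳ suc (maxList (map (V.lookup d) (preds g)))

maxFanIn : {inp j : ℕ} → Gates inp j → ℕ
maxFanIn inputs = 0
maxFanIn (gs ▷ g) = maxFanIn gs ⊔ fanIn g

record Circuit (inp k : ℕ) : Set where
  field
    size  : ℕ                       -- number of gates (including inputs)
    gates : Gates inp size
    out   : Vec (Fin size) k

module _ {inp k : ℕ} (C : Circuit inp k) where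
  open Circuit C

  run : Vec Bool inp → Vec Bool k
  run x = V.map (V.lookup (evalGates gates x)) out

  depth : ℕ
  depth = V.foldr _ _⊔_ 0 (V.map (V.lookup (gateDepths gates)) out)

  WellFormed : Set
  WellFormed = Injective _≡_ _≡_ (V.lookup out)
             × (∀ i a → ¬ Edge gates (V.lookup out i) a)
             × (∀ a → (∀ b → ¬ Edge gates a b) → ∃[ i ] V.lookup out i ≡ a)

record MPC (m Δ : ℕ) : Set where
  field
    k : ℕ
    C : Circuit (m + suc Δ * k) k
    A : Subset k
    P : Subset k

padTo : {X : Set} → (Δ : ℕ) → X → List X → Vec X Δ
padTo zero d xs = []
padTo (suc Δ) d [] = d ∷ padTo Δ d []
padTo (suc Δ) d (x ∷ xs) = x ∷ padTo Δ d xs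

module _ (isId : ℕ → Bool) (Π : List ℕ) {Δ : ℕ} (D : MPC (length Π) Δ) (M : Kripke (length Π)) where
  open MPC D

  mpcState : ℕ → W M → Vec Bool k
  mpcState zero w = run C (localInput M w ++ replicate (suc Δ * k) false)
  mpcState (suc t) w =
    run C (localInput M w ++ (mpcState t w ++
      concat (padTo Δ (replicate k false) (map (mpcState t) (neighbours isId Π M w)))))

  MPCAcceptsAt : W M → ℕ → Set
  MPCAcceptsAt w t = AcceptsAt A (λ s → mpcState s w) t

  MPCOutputsAt : W M → ℕ → List Bool → Set
  MPCOutputsAt w t o = OutputsAt A P (λ s → mpcState s w) t o

-- Modal substitution calculus.  Schema m h : schemata over the m symbols
-- of Π with schema variables Y₀..Y_{h-1}.  ML(Π) = Schema m 0.

data Schema (m h : ℕ) : Set where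
  ⊤'   : Schema m h
  prop : Fin m → Schema m h
  var  : Fin h → Schema m h
  ¬'   : Schema m h → Schema m h
  _∧'_ : Schema m h → Schema m h → Schema m h
  ◇    : Schema m h → Schema m h

substS : {m h h' : ℕ} → Schema m h → (Fin h → Schema m h') → Schema m h'
substS ⊤' σ = ⊤'
substS (prop p) σ = prop p
substS (var Y) σ = σ Y
substS (¬' φ) σ = ¬' (substS φ σ)
substS (φ ∧' ψ) σ = substS φ σ ∧' substS ψ σ
substS (◇ φ) σ = ◇ (substS φ σ)

sizeS : {m h : ℕ} → Schema m h → ℕ
sizeS ⊤' = 1
sizeS (prop p) = 1
sizeS (var Y) = 1
sizeS (¬' φ) = suc (sizeS φ)
sizeS (φ ∧' ψ) = suc (sizeS φ + sizeS ψ)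
sizeS (◇ φ) = suc (sizeS φ)

record Program (m : ℕ) : Set where
  field
    k    : ℕ
    term : Fin k → Schema m 0
    iter : Fin k → Schema m k
    A    : Subset k
    P    : Subset k

module _ {m : ℕ} (Pr : Program m) where
  open Program Pr

  iterFormula : ℕ → Fin k → Schema m 0
  iterFormula zero i = term i
  iterFormula (suc t) i = substS (iter i) (iterFormula t)

  -- size: occurrences in all clauses, counting the two head occurrences
  -- Yᵢ(0) and Yᵢ of each head predicate
  programSize : ℕ
  programSize = sum (map (λ i → 2 + sizeS (term i) + sizeS (iter i)) (allFin k))

module _ {m : ℕ} (M : Kripke m) where
  open Kripke M

  sat : Schema m 0 → W M → Bool
  sat ⊤' w = true
  sat (prop p) w = V p w
  sat (var ()) w
  sat (¬' φ) w = not (sat φ w)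
  sat (φ ∧' ψ) w = sat φ w ∧ sat ψ w
  sat (◇ φ) w = any (sat φ) (succs M w)

  module _ (Pr : Program m) where
    open Program Pr

    configuration : ℕ → W M → Vec Bool k
    configuration t w = tabulate (λ i → sat (iterFormula Pr t i) w)

    ProgAcceptsAt : W M → ℕ → Set
    ProgAcceptsAt w t = AcceptsAt A (λ s → configuration s w) t

    ProgOutputsAt : W M → ℕ → List Bool → Set
    ProgOutputsAt w t o = OutputsAt A P (λ s → configuration s w) t o

Equivalent : (isId : ℕ → Bool) (Π : List ℕ) (Δ : ℕ) →
             Program (length Π) → MPC (length Π) Δ → Set
Equivalent isId Π Δ Pr D =
  (M : Kripke (length Π)) → InClass isId Π M Δ → (w : W M) → (o : List Bool) →
    ((∃[ t ] ProgOutputsAt M Pr w t o) → (∃[ t ] MPCOutputsAt isId Π D M w t o))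
  × ((∃[ t ] MPCOutputsAt isId Π D M w t o) → (∃[ t ] ProgOutputsAt M Pr w t o))

-- The program simulates the MPC with one head predicate per state bit, one per gate of the
-- circuit, and a cyclic clock of length d + 2, where d is the depth.  A gate predicate applies its
-- gate to the previous round's values, so d rounds after the state last changed the gates hold the
-- circuit's output; when the clock ticks, the state predicates copy the output gates.  Each MPC
-- round thus costs d + 2 program rounds.  The state of the i-th neighbour is expressible in ML
-- because identifiers are the bit strings at the symbols of Π₁: running through all of them in
-- lexicographic order, "φ holds at the i-th neighbour" is a fixed Boolean combination of the
-- formulas ◇(ID = t ∧ φ).  Every clause then has size bounded in terms of Π, Δ and the fan-in
-- bound, and there are O(|C|) clauses, so the program is linear in the size of the circuit.

module Submission where

open import Defs
open import Data.Bool as Bool using (Bool; true; false; _∧_; _∨_; not; T; if_then_else_; f<t)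
import Data.Bool.Properties as Bool
open import Data.Bool.Properties using (∨-identityʳ; T-≡; T-∧)
open import Data.Bool.ListAction using (any; all; or; and)
open import Data.Empty using (⊥; ⊥-elim)
open import Data.Nat using (ℕ; zero; suc; _+_; _*_; _^_; _≤_; _<_; _⊔_; _≡ᵇ_; z≤n; s≤s; s≤s⁻¹; NonZero)
open import Data.Nat.Properties
  using ( ≤-refl; ≤-reflexive; ≤-trans; <-≤-trans; n≤1+n; m≤m+n; m≤n+m; <⇒≢; >⇒≢
        ; m≤m⊔n; m≤n⊔m; ⊔-lub; +-suc; +-mono-≤; +-monoʳ-≤; *-comm; *-monoˡ-≤; *-monoʳ-≤; *-monoˡ-<; m^n>0)
open import Data.Nat.DivMod using (_/_; _%_; m≡m%n+[m/n]*n; m%n<n; m*n/n≡m; m<n*o⇒m/o<n; m/n*n≤m)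
open import Data.Nat.ListAction using (sum)
open import Data.Nat.Tactic.RingSolver using (solve-∀)
open import Data.Fin using (Fin; zero; suc; toℕ; fromℕ; inject₁; _↑ˡ_; _↑ʳ_; splitAt)
open import Data.Fin.Properties using (splitAt-↑ˡ; splitAt-↑ʳ; toℕ-fromℕ; toℕ-inject₁; toℕ<n; injective⇒≤)
open import Data.Fin.Subset using (Subset)
open import Data.List as List using (List; []; _∷_; map; filterᵇ; length; allFin)
open import Data.List.NonEmpty using (toList)
open import Data.List.Properties using (map-cong; map-cong-local; map-∘; length-map; length-tabulate)
open import Data.List.Membership.Propositional using (_∈_; find; lose)
open import Data.List.Membership.Propositional.Properties using (∈-map⁻; ∈-map⁺; ∈-++⁺ˡ; ∈-++⁺ʳ; ∈-filter⁻; ∈-filter⁺; ∈-allFin)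
open import Data.List.Relation.Unary.Any using (here; there)
open import Data.List.Relation.Unary.Any.Properties using (any⁺; any⁻)
open import Data.List.Relation.Unary.All as All using (All; []; _∷_)
open import Data.List.Relation.Unary.AllPairs as AllPairs using (AllPairs; []; _∷_)
import Data.List.Relation.Unary.AllPairs.Properties as AllPairs
import Data.List.Relation.Unary.Unique.Propositional.Properties as Unique
open import Data.List.Relation.Unary.Linked using (Linked)
open import Data.List.Relation.Binary.Lex.Strict using (Lex-<; this; next; halt; <-irreflexive; <-transitive)
import Data.List.Relation.Binary.Pointwise as Pointwise
open import Data.Vec as Vec using (Vec; []; _∷_; _∷ʳ_; _++_; replicate; concat; tabulate; lookup)
open import Data.Vec.Properties
  using (lookup-replicate; map-++; map-concat; lookup-map; tabulate-∘; tabulate-cong; tabulate∘lookup; map-const)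
import Data.Vec.Relation.Unary.All as VecAll
import Data.Vec.Relation.Unary.All.Properties as VecAll
open import Data.Product using (Σ; ∃-syntax; _×_; _,_; proj₁; proj₂)
open import Data.Sum using (_⊎_; inj₁; inj₂; [_,_]′)
open import Function using (_∘_; _on_; const)
open import Function.Bundles using (Equivalence)
open import Level using (0ℓ)
open import Relation.Nullary using (¬_; contradiction)
open import Relation.Nullary.Decidable using (T?)
open import Relation.Binary.Core using (Rel)
open import Relation.Binary.Definitions using (Transitive)
open import Relation.Binary.PropositionalEquality
  using (_≡_; _≢_; refl; sym; trans; cong; cong₂; subst; resp₂; isEquivalence; module ≡-Reasoning)

any-cong : {A : Set} {f g : A → Bool} (xs : List A) →
           (∀ x → x ∈ xs → f x ≡ g x) → any f xs ≡ any g xs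
any-cong xs f≡g = cong or (map-cong-local (All.tabulate (f≡g _)))

all-cong : {A : Set} {f g : A → Bool} (xs : List A) →
           (∀ x → x ∈ xs → f x ≡ g x) → all f xs ≡ all g xs
all-cong xs f≡g = cong and (map-cong-local (All.tabulate (f≡g _)))

any-false : {A : Set} (f : A → Bool) (xs : List A) → (∀ x → ¬ T (f x)) → any f xs ≡ false
any-false f [] never = refl
any-false f (x ∷ xs) never with f x in fx
... | true  = ⊥-elim (never x (subst T (sym fx) _))
... | false = any-false f xs never

any-unique : {A : Set} (f : A → Bool) {xs : List A} {v : A} → v ∈ xs →
             (∀ u → T (f u) → u ≡ v) → any f xs ≡ f v
any-unique f {x ∷ xs} (here refl) only-v with f x in fx
... | true  = refl
... | false = any-false f xs (λ u fu → subst T fx (subst (T ∘ f) (only-v u fu) fu))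
any-unique f {x ∷ xs} (there v∈xs) only-v with f x in fx
... | true  = sym (subst (λ z → f z ≡ true) (only-v x (subst T (sym fx) _)) fx)
... | false = any-unique f v∈xs only-v

-- Sorted lists and the lexicographic order on bit strings

module _ {A : Set} {_<_ : Rel A 0ℓ} (<-irrefl : ∀ x → ¬ x < x) (<-trans : Transitive _<_) where

  private
    ¬-both : ∀ {x y} → x < y → y < x → ⊥
    ¬-both x<y y<x = <-irrefl _ (<-trans x<y y<x)

  sorted-unique : ∀ {xs ys} → AllPairs _<_ xs → AllPairs _<_ ys →
                  (∀ t → t ∈ xs → t ∈ ys) → (∀ t → t ∈ ys → t ∈ xs) → xs ≡ ys
  sorted-unique {[]} {[]} _ _ _ _ = refl
  sorted-unique {[]} {y ∷ ys} _ _ _ ys⊆xs with ys⊆xs y (here refl)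
  ... | ()
  sorted-unique {x ∷ xs} {[]} _ _ xs⊆ys _ with xs⊆ys x (here refl)
  ... | ()
  sorted-unique {x ∷ xs} {y ∷ ys} (x< ∷ sxs) (y< ∷ sys) xs⊆ys ys⊆xs =
    cong₂ _∷_ x≡y (sorted-unique sxs sys xs'⊆ys' ys'⊆xs')
    where
    x≡y : x ≡ y
    x≡y with xs⊆ys x (here refl) | ys⊆xs y (here refl)
    ... | here x≡y  | _          = x≡y
    ... | there _   | here y≡x   = sym y≡x
    ... | there x∈ys | there y∈xs = ⊥-elim (¬-both (All.lookup x< y∈xs) (All.lookup y< x∈ys))
    xs'⊆ys' : ∀ t → t ∈ xs → t ∈ ys
    xs'⊆ys' t t∈xs with xs⊆ys t (there t∈xs)
    ... | here refl = ⊥-elim (<-irrefl t (subst (_< t) x≡y (All.lookup x< t∈xs)))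
    ... | there t∈ys = t∈ys
    ys'⊆xs' : ∀ t → t ∈ ys → t ∈ xs
    ys'⊆xs' t t∈ys with ys⊆xs t (there t∈ys)
    ... | here refl = ⊥-elim (<-irrefl t (subst (_< t) (sym x≡y) (All.lookup y< t∈ys)))
    ... | there t∈xs = t∈xs

infix 4 _<ᴸ_
_<ᴸ_ : Rel (List Bool) 0ℓ
_<ᴸ_ = Lex-< _≡_ Bool._<_

<ᴸ-irrefl : ∀ s → ¬ s <ᴸ s
<ᴸ-irrefl s = <-irreflexive Bool.<-irrefl (Pointwise.refl refl)

<ᴸ-trans : Transitive _<ᴸ_
<ᴸ-trans = <-transitive isEquivalence (resp₂ Bool._<_) Bool.<-trans

lex≤-false⇒> : ∀ s t → lex≤ s t ≡ false → t <ᴸ s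
lex≤-false⇒> (b ∷ s) [] _ = halt
lex≤-false⇒> (false ∷ s) (false ∷ t) s≰t = next refl (lex≤-false⇒> s t s≰t)
lex≤-false⇒> (true ∷ s) (true ∷ t) s≰t = next refl (lex≤-false⇒> s t s≰t)
lex≤-false⇒> (true ∷ s) (false ∷ t) _ = this f<t

lex≤-true⇒< : ∀ s t → lex≤ s t ≡ true → s ≢ t → s <ᴸ t
lex≤-true⇒< [] [] _ s≢t = contradiction refl s≢t
lex≤-true⇒< [] (b ∷ t) _ _ = halt
lex≤-true⇒< (false ∷ s) (false ∷ t) s≤t s≢t = next refl (lex≤-true⇒< s t s≤t (s≢t ∘ cong (false ∷_)))
lex≤-true⇒< (true ∷ s) (true ∷ t) s≤t s≢t = next refl (lex≤-true⇒< s t s≤t (s≢t ∘ cong (true ∷_)))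
lex≤-true⇒< (false ∷ s) (true ∷ t) _ _ = this f<t

module _ {A : Set} (key : A → List Bool) where

  ∈-insertBy⁻ : ∀ {a y} S → y ∈ insertBy key a S → y ≡ a ⊎ y ∈ S
  ∈-insertBy⁻ [] (here y≡a) = inj₁ y≡a
  ∈-insertBy⁻ {a} (b ∷ S) y∈ with lex≤ (key a) (key b) | y∈
  ... | true  | here y≡a = inj₁ y≡a
  ... | true  | there y∈S = inj₂ y∈S
  ... | false | here y≡b = inj₂ (here y≡b)
  ... | false | there y∈ with ∈-insertBy⁻ S y∈
  ...   | inj₁ y≡a = inj₁ y≡a
  ...   | inj₂ y∈S = inj₂ (there y∈S)

  ∈-insertBy⁺ : ∀ {a y} S → y ≡ a ⊎ y ∈ S → y ∈ insertBy key a S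
  ∈-insertBy⁺ [] (inj₁ y≡a) = here y≡a
  ∈-insertBy⁺ {a} (b ∷ S) y∈ with lex≤ (key a) (key b) | y∈
  ... | true  | inj₁ y≡a = here y≡a
  ... | true  | inj₂ y∈S = there y∈S
  ... | false | inj₁ y≡a = there (∈-insertBy⁺ S (inj₁ y≡a))
  ... | false | inj₂ (here y≡b) = here y≡b
  ... | false | inj₂ (there y∈S) = there (∈-insertBy⁺ S (inj₂ y∈S))

  ∈-sortBy⁻ : ∀ {y} S → y ∈ sortBy key S → y ∈ S
  ∈-sortBy⁻ (x ∷ S) y∈ with ∈-insertBy⁻ (sortBy key S) y∈
  ... | inj₁ refl = here refl
  ... | inj₂ y∈S = there (∈-sortBy⁻ S y∈S)

  ∈-sortBy⁺ : ∀ {y} S → y ∈ S → y ∈ sortBy key S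
  ∈-sortBy⁺ (x ∷ S) (here refl) = ∈-insertBy⁺ (sortBy key S) (inj₁ refl)
  ∈-sortBy⁺ (x ∷ S) (there y∈S) = ∈-insertBy⁺ (sortBy key S) (inj₂ (∈-sortBy⁺ S y∈S))

  Sorted : List A → Set
  Sorted = AllPairs (_<ᴸ_ on key)

  insertBy-sorted : ∀ a S → Sorted S → (∀ y → y ∈ S → key a ≢ key y) → Sorted (insertBy key a S)
  insertBy-sorted a [] [] _ = [] ∷ []
  insertBy-sorted a (b ∷ S) (b< ∷ sS) a-new with lex≤ (key a) (key b) in a≤b
  ... | true  = All.tabulate a<y ∷ b< ∷ sS
    where
    a<b = lex≤-true⇒< (key a) (key b) a≤b (a-new b (here refl))
    a<y : ∀ {y} → y ∈ b ∷ S → key a <ᴸ key y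
    a<y (here refl) = a<b
    a<y (there y∈S) = <ᴸ-trans a<b (All.lookup b< y∈S)
  ... | false = All.tabulate b<y ∷ insertBy-sorted a S sS (λ y y∈S → a-new y (there y∈S))
    where
    b<y : ∀ {y} → y ∈ insertBy key a S → key b <ᴸ key y
    b<y y∈ with ∈-insertBy⁻ S y∈
    ... | inj₁ refl = lex≤-false⇒> (key a) (key b) a≤b
    ... | inj₂ y∈S = All.lookup b< y∈S

  sortBy-sorted : ∀ S → AllPairs (λ x y → key x ≢ key y) S → Sorted (sortBy key S)
  sortBy-sorted [] [] = []
  sortBy-sorted (x ∷ S) (x≢ ∷ distinct) =
    insertBy-sorted x (sortBy key S) (sortBy-sorted S distinct) (λ y y∈ → All.lookup x≢ (∈-sortBy⁻ S y∈))

bitStrings : ℕ → List (List Bool)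
bitStrings zero = [] ∷ []
bitStrings (suc n) = map (false ∷_) (bitStrings n) List.++ map (true ∷_) (bitStrings n)

bitStrings-sorted : ∀ n → AllPairs _<ᴸ_ (bitStrings n)
bitStrings-sorted zero = [] ∷ []
bitStrings-sorted (suc n) =
  AllPairs.++⁺ (prefixed false) (prefixed true) (All.tabulate (λ p → All.tabulate (cross p)))
  where
  prefixed : ∀ b → AllPairs _<ᴸ_ (map (b ∷_) (bitStrings n))
  prefixed b = AllPairs.map⁺ (AllPairs.map (next refl) (bitStrings-sorted n))
  cross : ∀ {s t} → s ∈ map (false ∷_) (bitStrings n) → t ∈ map (true ∷_) (bitStrings n) → s <ᴸ t
  cross s∈ t∈ with ∈-map⁻ (false ∷_) s∈ | ∈-map⁻ (true ∷_) t∈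
  ... | _ , _ , refl | _ , _ , refl = this f<t

∈-bitStrings : ∀ s → s ∈ bitStrings (length s)
∈-bitStrings [] = here refl
∈-bitStrings (false ∷ s) = ∈-++⁺ˡ (∈-map⁺ (false ∷_) (∈-bitStrings s))
∈-bitStrings (true ∷ s) = ∈-++⁺ʳ _ (∈-map⁺ (true ∷_) (∈-bitStrings s))

module _ {m : ℕ} (M : Kripke m) where
  open Kripke M

  evalS : ∀ {h} → Schema m h → (Fin h → W M → Bool) → W M → Bool
  evalS ⊤' ρ w = true
  evalS (prop p) ρ w = V p w
  evalS (var Y) ρ w = ρ Y w
  evalS (¬' φ) ρ w = not (evalS φ ρ w)
  evalS (φ ∧' ψ) ρ w = evalS φ ρ w ∧ evalS ψ ρ w
  evalS (◇ φ) ρ w = any (evalS φ ρ) (succs M w)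

  sat-substS : ∀ {h} (φ : Schema m h) (σ : Fin h → Schema m 0) w →
               sat M (substS φ σ) w ≡ evalS φ (λ Y → sat M (σ Y)) w
  sat-substS ⊤' σ w = refl
  sat-substS (prop p) σ w = refl
  sat-substS (var Y) σ w = refl
  sat-substS (¬' φ) σ w = cong not (sat-substS φ σ w)
  sat-substS (φ ∧' ψ) σ w = cong₂ _∧_ (sat-substS φ σ w) (sat-substS ψ σ w)
  sat-substS (◇ φ) σ w = any-cong (succs M w) (λ v _ → sat-substS φ σ v)

⊥' : ∀ {m h} → Schema m h
⊥' = ¬' ⊤'

_∨'_ : ∀ {m h} → Schema m h → Schema m h → Schema m h
φ ∨' ψ = ¬' (¬' φ ∧' ¬' ψ)

evalS-∨' : ∀ {m h} (M : Kripke m) (φ ψ : Schema m h) ρ w →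
           evalS M (φ ∨' ψ) ρ w ≡ (evalS M φ ρ w ∨ evalS M ψ ρ w)
evalS-∨' M φ ψ ρ w with evalS M φ ρ w | evalS M ψ ρ w
... | true  | _     = refl
... | false | true  = refl
... | false | false = refl

-- Naming the i-th neighbour

bitEq : Bool → Bool → Bool
bitEq a b = if b then a else not a

bitsEq : List Bool → List Bool → Bool
bitsEq [] [] = true
bitsEq [] (_ ∷ _) = false
bitsEq (_ ∷ _) [] = false
bitsEq (a ∷ s) (b ∷ t) = bitEq a b ∧ bitsEq s t

bitsEq-sound : ∀ s t → T (bitsEq s t) → s ≡ t
bitsEq-sound [] [] _ = refl
bitsEq-sound (false ∷ s) (false ∷ t) eq = cong (false ∷_) (bitsEq-sound s t eq)
bitsEq-sound (true ∷ s) (true ∷ t) eq = cong (true ∷_) (bitsEq-sound s t eq)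

bitsEq-refl : ∀ s → bitsEq s s ≡ true
bitsEq-refl [] = refl
bitsEq-refl (false ∷ s) = bitsEq-refl s
bitsEq-refl (true ∷ s) = bitsEq-refl s

literal : ∀ {m h} → Fin m → Bool → Schema m h
literal i true = prop i
literal i false = ¬' (prop i)

idFormula : ∀ {m h} → List (Fin m) → List Bool → Schema m h
idFormula [] [] = ⊤'
idFormula [] (_ ∷ _) = ⊥'
idFormula (_ ∷ _) [] = ⊥'
idFormula (i ∷ ids) (b ∷ t) = literal i b ∧' idFormula ids t

nthOr : {X : Set} → List X → ℕ → X → X
nthOr [] n d = d
nthOr (x ∷ xs) zero d = x
nthOr (x ∷ xs) (suc n) d = nthOr xs n d

-- atNeighbour ids Ts n φ says that φ holds at the n-th successor, successors being
-- ordered by the position in Ts of their identifier (their bits at the symbols ids).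
module _ {m : ℕ} (ids : List (Fin m)) where

  atNeighbour : ∀ {h} → List (List Bool) → ℕ → Schema m h → Schema m h
  atNeighbourFrom : ∀ {h} → List Bool → List (List Bool) → ℕ → Schema m h → Schema m h
  atNeighbour [] n φ = ⊥'
  atNeighbour (t ∷ Ts) n φ =
    (◇ (idFormula ids t) ∧' atNeighbourFrom t Ts n φ) ∨' (¬' (◇ (idFormula ids t)) ∧' atNeighbour Ts n φ)
  atNeighbourFrom t Ts zero φ = ◇ (idFormula ids t ∧' φ)
  atNeighbourFrom t Ts (suc n) φ = atNeighbour Ts n φ

  module _ (M : Kripke m) where
    open Kripke M

    idBits : W M → List Bool
    idBits u = map (λ i → V i u) ids

    evalS-idFormula : ∀ {h} ids′ t (ρ : Fin h → W M → Bool) u →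
                      evalS M (idFormula ids′ t) ρ u ≡ bitsEq (map (λ i → V i u) ids′) t
    evalS-idFormula [] [] ρ u = refl
    evalS-idFormula [] (_ ∷ _) ρ u = refl
    evalS-idFormula (_ ∷ _) [] ρ u = refl
    evalS-idFormula (i ∷ ids′) (true ∷ t) ρ u = cong (V i u ∧_) (evalS-idFormula ids′ t ρ u)
    evalS-idFormula (i ∷ ids′) (false ∷ t) ρ u = cong (not (V i u) ∧_) (evalS-idFormula ids′ t ρ u)

    present : W M → List Bool → Bool
    present w t = any (λ u → bitsEq (idBits u) t) (succs M w)

    evalS-atNeighbour : ∀ {h} Ts n (φ : Schema m h) ρ w →
      evalS M (atNeighbour Ts n φ) ρ w ≡
      nthOr (map (λ t → evalS M (◇ (idFormula ids t ∧' φ)) ρ w) (filterᵇ (present w) Ts)) n false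
    evalS-atNeighbour [] n φ ρ w = refl
    evalS-atNeighbour (t ∷ Ts) n φ ρ w
      rewrite evalS-∨' M (◇ (idFormula ids t) ∧' atNeighbourFrom t Ts n φ)
                         (¬' (◇ (idFormula ids t)) ∧' atNeighbour Ts n φ) ρ w
            | any-cong (succs M w) (λ u _ → evalS-idFormula ids t ρ u)
      with present w t
    ... | true  = trans (∨-identityʳ _) (from n)
      where
      from : ∀ n → evalS M (atNeighbourFrom t Ts n φ) ρ w ≡
             nthOr (map (λ t → evalS M (◇ (idFormula ids t ∧' φ)) ρ w) (t ∷ filterᵇ (present w) Ts)) n false
      from zero = refl
      from (suc n) = evalS-atNeighbour Ts n φ ρ w
    ... | false = evalS-atNeighbour Ts n φ ρ w

module _ (isId : ℕ → Bool) (Π : List ℕ) (M : Kripke (length Π)) (hid : HasIdentifiers isId Π M) where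
  open Kripke M

  private
    ids = idPositions isId Π
    IDᴹ = ID isId Π M

  succs-distinctIds : ∀ w → AllPairs (λ u v → IDᴹ u ≢ IDᴹ v) (succs M w)
  succs-distinctIds w = AllPairs.map (λ u≢v → u≢v ∘ hid) (Unique.filter⁺ (T? ∘ R w) (Unique.allFin⁺ _))

  -- Both sides are strictly sorted lists with the same elements.
  present-bitStrings : ∀ w → filterᵇ (present ids M w) (bitStrings (length ids)) ≡ map IDᴹ (neighbours isId Π M w)
  present-bitStrings w =
    sorted-unique <ᴸ-irrefl <ᴸ-trans
      (AllPairs.filter⁺ (T? ∘ present ids M w) (bitStrings-sorted (length ids)))
      (AllPairs.map⁺ (sortBy-sorted IDᴹ (succs M w) (succs-distinctIds w)))
      present⇒neighbour neighbour⇒present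
    where
    present⇒neighbour : ∀ t → t ∈ filterᵇ (present ids M w) (bitStrings (length ids)) →
                        t ∈ map IDᴹ (neighbours isId Π M w)
    present⇒neighbour t t∈
      with find (any⁻ _ (succs M w) (proj₂ (∈-filter⁻ (T? ∘ present ids M w) {xs = bitStrings (length ids)} t∈)))
    ... | u , u∈ , u≡t with bitsEq-sound (IDᴹ u) t u≡t
    ... | refl = ∈-map⁺ IDᴹ (∈-sortBy⁺ IDᴹ (succs M w) u∈)
    neighbour⇒present : ∀ t → t ∈ map IDᴹ (neighbours isId Π M w) →
                        t ∈ filterᵇ (present ids M w) (bitStrings (length ids))
    neighbour⇒present t t∈ with ∈-map⁻ IDᴹ t∈
    ... | u , u∈ , refl = ∈-filter⁺ (T? ∘ present ids M w)
      (subst (λ n → IDᴹ u ∈ bitStrings n) (length-map _ ids) (∈-bitStrings (IDᴹ u)))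
      (any⁺ _ (lose (∈-sortBy⁻ IDᴹ (succs M w) u∈) (Equivalence.from T-≡ (bitsEq-refl (IDᴹ u)))))

  evalS-◇-idFormula : ∀ {h} (φ : Schema (length Π) h) ρ {w v} → v ∈ succs M w →
                      evalS M (◇ (idFormula ids (IDᴹ v) ∧' φ)) ρ w ≡ evalS M φ ρ v
  evalS-◇-idFormula φ ρ {w} {v} v∈ = begin
    any (λ u → evalS M (idFormula ids (IDᴹ v)) ρ u ∧ evalS M φ ρ u) (succs M w)
      ≡⟨ any-cong (succs M w) (λ u _ → cong (_∧ evalS M φ ρ u) (evalS-idFormula ids M ids (IDᴹ v) ρ u)) ⟩
    any (λ u → bitsEq (IDᴹ u) (IDᴹ v) ∧ evalS M φ ρ u) (succs M w)
      ≡⟨ any-unique _ v∈ (λ u u≈v → hid (bitsEq-sound _ _ (proj₁ (Equivalence.to T-∧ u≈v)))) ⟩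
    bitsEq (IDᴹ v) (IDᴹ v) ∧ evalS M φ ρ v
      ≡⟨ cong (_∧ evalS M φ ρ v) (bitsEq-refl (IDᴹ v)) ⟩
    evalS M φ ρ v ∎
    where open ≡-Reasoning

  evalS-atNeighbour-bitStrings : ∀ {h} n (φ : Schema (length Π) h) ρ w →
    evalS M (atNeighbour ids (bitStrings (length ids)) n φ) ρ w ≡
    nthOr (map (evalS M φ ρ) (neighbours isId Π M w)) n false
  evalS-atNeighbour-bitStrings n φ ρ w = begin
    evalS M (atNeighbour ids (bitStrings (length ids)) n φ) ρ w
      ≡⟨ evalS-atNeighbour ids M (bitStrings (length ids)) n φ ρ w ⟩
    nthOr (map diamond (filterᵇ (present ids M w) (bitStrings (length ids)))) n false
      ≡⟨ cong (λ ts → nthOr (map diamond ts) n false) (present-bitStrings w) ⟩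
    nthOr (map diamond (map IDᴹ nbs)) n false
      ≡⟨ cong (λ xs → nthOr xs n false) (sym (map-∘ nbs)) ⟩
    nthOr (map (diamond ∘ IDᴹ) nbs) n false
      ≡⟨ cong (λ xs → nthOr xs n false) (map-cong-local (All.tabulate
           (λ v∈ → evalS-◇-idFormula φ ρ (∈-sortBy⁻ IDᴹ (succs M w) v∈)))) ⟩
    nthOr (map (evalS M φ ρ) nbs) n false ∎
    where
    open ≡-Reasoning
    nbs = neighbours isId Π M w
    diamond : List Bool → Bool
    diamond t = evalS M (◇ (idFormula ids t ∧' φ)) ρ w

-- Circuits

data GateDef (inp j : ℕ) : Set where
  input : Fin inp → GateDef inp j
  conj  : List (Fin j) → GateDef inp j
  disj  : List (Fin j) → GateDef inp j
  neg   : Fin j → GateDef inp j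

defVal : ∀ {inp j} → GateDef inp j → Vec Bool inp → (Fin j → Bool) → Bool
defVal (input a) x val = lookup x a
defVal (conj ps) x val = all val ps
defVal (disj ps) x val = any val ps
defVal (neg p) x val = not (val p)

defPreds : ∀ {inp j} → GateDef inp j → List (Fin j)
defPreds (input a) = []
defPreds (conj ps) = ps
defPreds (disj ps) = ps
defPreds (neg p) = p ∷ []

weaken : ∀ {inp j} → GateDef inp j → GateDef inp (suc j)
weaken (input a) = input a
weaken (conj ps) = conj (map inject₁ ps)
weaken (disj ps) = disj (map inject₁ ps)
weaken (neg p) = neg (inject₁ p)

fromGate : ∀ {inp j} → Gate j → GateDef inp j
fromGate (AND ps) = conj (toList ps)
fromGate (OR ps) = disj (toList ps)
fromGate (NOT p) = neg p

data LastOrInject₁ : ∀ {j} → Fin (suc j) → Set where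
  last    : ∀ {j} → LastOrInject₁ (fromℕ j)
  inject  : ∀ {j} (i : Fin j) → LastOrInject₁ (inject₁ i)

lastOrInject₁ : ∀ {j} (i : Fin (suc j)) → LastOrInject₁ i
lastOrInject₁ {zero} zero = last
lastOrInject₁ {suc j} zero = inject zero
lastOrInject₁ {suc j} (suc i) with lastOrInject₁ i
... | last = last
... | inject i′ = inject (suc i′)

gateDef : ∀ {inp j} → Gates inp j → Fin j → GateDef inp j
gateDef inputs a = input a
gateDef (gs ▷ g) a with lastOrInject₁ a
... | last = weaken (fromGate g)
... | inject a′ = weaken (gateDef gs a′)

defVal-weaken : ∀ {inp j} (d : GateDef inp j) x (val : Fin (suc j) → Bool) →
                defVal (weaken d) x val ≡ defVal d x (val ∘ inject₁)
defVal-weaken (input a) x val = refl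
defVal-weaken (conj ps) x val = cong and (sym (map-∘ ps))
defVal-weaken (disj ps) x val = cong or (sym (map-∘ ps))
defVal-weaken (neg p) x val = refl

defVal-cong : ∀ {inp j} (d : GateDef inp j) x {val val′ : Fin j → Bool} →
              (∀ p → p ∈ defPreds d → val p ≡ val′ p) → defVal d x val ≡ defVal d x val′
defVal-cong (input a) x eq = refl
defVal-cong (conj ps) x eq = all-cong ps eq
defVal-cong (disj ps) x eq = any-cong ps eq
defVal-cong (neg p) x eq = cong not (eq p (here refl))

defPreds-weaken : ∀ {inp j} (d : GateDef inp j) → defPreds (weaken d) ≡ map inject₁ (defPreds d)
defPreds-weaken (input a) = refl
defPreds-weaken (conj ps) = refl
defPreds-weaken (disj ps) = refl
defPreds-weaken (neg p) = refl

defPreds-fromGate : ∀ {inp j} (g : Gate j) → defPreds {inp} (fromGate g) ≡ preds g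
defPreds-fromGate (AND ps) = refl
defPreds-fromGate (OR ps) = refl
defPreds-fromGate (NOT p) = refl

lookup-∷ʳ-inject₁ : ∀ {A : Set} {j} (v : Vec A j) y i → lookup (v ∷ʳ y) (inject₁ i) ≡ lookup v i
lookup-∷ʳ-inject₁ (x ∷ v) y zero = refl
lookup-∷ʳ-inject₁ (x ∷ v) y (suc i) = lookup-∷ʳ-inject₁ v y i

lookup-∷ʳ-last : ∀ {A : Set} {j} (v : Vec A j) y → lookup (v ∷ʳ y) (fromℕ j) ≡ y
lookup-∷ʳ-last [] y = refl
lookup-∷ʳ-last (x ∷ v) y = lookup-∷ʳ-last v y

evalGates-gateDef : ∀ {inp j} (gs : Gates inp j) x a →
                    lookup (evalGates gs x) a ≡ defVal (gateDef gs a) x (lookup (evalGates gs x))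
evalGates-gateDef inputs x a = refl
evalGates-gateDef (gs ▷ g) x a with lastOrInject₁ a
... | last = begin
  lookup (v ∷ʳ gateVal g v) (fromℕ _)                       ≡⟨ lookup-∷ʳ-last v _ ⟩
  gateVal g v                                               ≡⟨ defVal-fromGate g ⟩
  defVal (fromGate g) x (lookup v)                          ≡⟨ defVal-cong (fromGate g) x (λ p _ → sym (lookup-∷ʳ-inject₁ v _ p)) ⟩
  defVal (fromGate g) x (lookup (v ∷ʳ gateVal g v) ∘ inject₁) ≡⟨ sym (defVal-weaken (fromGate g) x _) ⟩
  defVal (weaken (fromGate g)) x (lookup (v ∷ʳ gateVal g v)) ∎
  where
  open ≡-Reasoning
  v = evalGates gs x
  defVal-fromGate : ∀ g → gateVal g v ≡ defVal (fromGate g) x (lookup v)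
  defVal-fromGate (AND ps) = refl
  defVal-fromGate (OR ps) = refl
  defVal-fromGate (NOT p) = refl
... | inject a′ = begin
  lookup (v ∷ʳ gateVal g v) (inject₁ a′)                      ≡⟨ lookup-∷ʳ-inject₁ v _ a′ ⟩
  lookup v a′                                                ≡⟨ evalGates-gateDef gs x a′ ⟩
  defVal (gateDef gs a′) x (lookup v)                        ≡⟨ defVal-cong (gateDef gs a′) x (λ p _ → sym (lookup-∷ʳ-inject₁ v _ p)) ⟩
  defVal (gateDef gs a′) x (lookup (v ∷ʳ gateVal g v) ∘ inject₁) ≡⟨ sym (defVal-weaken (gateDef gs a′) x _) ⟩
  defVal (weaken (gateDef gs a′)) x (lookup (v ∷ʳ gateVal g v)) ∎
  where
  open ≡-Reasoning
  v = evalGates gs x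

maxList-upper : ∀ {xs y} → y ∈ xs → y ≤ maxList xs
maxList-upper {x ∷ xs} (here refl) = m≤m⊔n x (maxList xs)
maxList-upper {x ∷ xs} (there y∈) = ≤-trans (maxList-upper y∈) (m≤n⊔m x (maxList xs))

maxList-least : ∀ xs {b} → (∀ {y} → y ∈ xs → y ≤ b) → maxList xs ≤ b
maxList-least [] bound = z≤n
maxList-least (x ∷ xs) bound = ⊔-lub (bound (here refl)) (maxList-least xs (bound ∘ there))

foldr-⊔-upper : ∀ {n} (v : Vec ℕ n) i → lookup v i ≤ Vec.foldr _ _⊔_ 0 v
foldr-⊔-upper (x ∷ v) zero = m≤m⊔n x _
foldr-⊔-upper (x ∷ v) (suc i) = ≤-trans (foldr-⊔-upper v i) (m≤n⊔m x _)

foldr-⊔-least : ∀ {n b} (v : Vec ℕ n) → (∀ i → lookup v i ≤ b) → Vec.foldr _ _⊔_ 0 v ≤ b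
foldr-⊔-least [] bound = z≤n
foldr-⊔-least (x ∷ v) bound = ⊔-lub (bound zero) (foldr-⊔-least v (bound ∘ suc))

gateDepth : ∀ {inp j} → Gates inp j → Fin j → ℕ
gateDepth gs a = lookup (gateDepths gs) a

gateDepth-▷-inject₁ : ∀ {inp j} (gs : Gates inp j) g a → gateDepth (gs ▷ g) (inject₁ a) ≡ gateDepth gs a
gateDepth-▷-inject₁ gs g a = lookup-∷ʳ-inject₁ (gateDepths gs) _ a

gateDepth-▷-last : ∀ {inp j} (gs : Gates inp j) g →
                   gateDepth (gs ▷ g) (fromℕ j) ≡ suc (maxList (map (gateDepth gs) (preds g)))
gateDepth-▷-last gs g = lookup-∷ʳ-last (gateDepths gs) _

gateDepth-pred : ∀ {inp j} (gs : Gates inp j) a {p} → p ∈ defPreds (gateDef gs a) →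
                 suc (gateDepth gs p) ≤ gateDepth gs a
gateDepth-pred (gs ▷ g) a p∈ with lastOrInject₁ a
... | last
  with ∈-map⁻ inject₁ (subst (_ ∈_) (trans (defPreds-weaken (fromGate g)) (cong (map inject₁) (defPreds-fromGate g))) p∈)
...   | p′ , p′∈ , refl rewrite gateDepth-▷-inject₁ gs g p′ | gateDepth-▷-last gs g =
        s≤s (maxList-upper (∈-map⁺ (gateDepth gs) p′∈))
gateDepth-pred (gs ▷ g) a p∈ | inject a′ with ∈-map⁻ inject₁ (subst (_ ∈_) (defPreds-weaken (gateDef gs a′)) p∈)
...   | p′ , p′∈ , refl rewrite gateDepth-▷-inject₁ gs g p′ | gateDepth-▷-inject₁ gs g a′ =
        gateDepth-pred gs a′ p′∈

gateDepth-≤-size : ∀ {inp j} (gs : Gates inp j) a → gateDepth gs a ≤ j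
gateDepth-≤-size {inp} inputs a rewrite lookup-replicate a 0 = z≤n
gateDepth-≤-size (gs ▷ g) a with lastOrInject₁ a
... | last rewrite gateDepth-▷-last gs g = s≤s (maxList-least _ bound)
  where
  bound : ∀ {y} → y ∈ map (gateDepth gs) (preds g) → y ≤ _
  bound y∈ with ∈-map⁻ (gateDepth gs) y∈
  ... | p , _ , refl = gateDepth-≤-size gs p
... | inject a′ rewrite gateDepth-▷-inject₁ gs g a′ = ≤-trans (gateDepth-≤-size gs a′) (n≤1+n _)

fanIn-gateDef : ∀ {inp j} (gs : Gates inp j) a → length (defPreds (gateDef gs a)) ≤ maxFanIn gs
fanIn-gateDef inputs a = z≤n
fanIn-gateDef {inp} (gs ▷ g) a with lastOrInject₁ a
... | last rewrite defPreds-weaken {inp} (fromGate g) | length-map inject₁ (defPreds {inp} (fromGate g))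
                 | defPreds-fromGate {inp} g = m≤n⊔m (maxFanIn gs) (fanIn g)
... | inject a′ rewrite defPreds-weaken (gateDef gs a′) | length-map inject₁ (defPreds (gateDef gs a′)) =
  ≤-trans (fanIn-gateDef gs a′) (m≤m⊔n (maxFanIn gs) (fanIn g))

module _ {inp j} (gs : Gates inp j) (x : Vec Bool inp) (input : ℕ → Vec Bool inp) (val : ℕ → Fin j → Bool)
         (val-step : ∀ r a → val (suc r) a ≡ defVal (gateDef gs a) (input r) (val r)) where

  lockstep-eval : ∀ r₀ d → (∀ i → i ≤ d → input (i + r₀) ≡ x) →
                  ∀ a → gateDepth gs a ≤ d → val (suc (d + r₀)) a ≡ lookup (evalGates gs x) a
  preds-ready : ∀ r₀ d → (∀ i → i ≤ d → input (i + r₀) ≡ x) →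
                ∀ a → gateDepth gs a ≤ d → ∀ p → p ∈ defPreds (gateDef gs a) →
                val (d + r₀) p ≡ lookup (evalGates gs x) p

  lockstep-eval r₀ d input≡x a depth≤d = begin
    val (suc (d + r₀)) a                                   ≡⟨ val-step (d + r₀) a ⟩
    defVal (gateDef gs a) (input (d + r₀)) (val (d + r₀)) ≡⟨ cong (λ y → defVal (gateDef gs a) y _) (input≡x d ≤-refl) ⟩
    defVal (gateDef gs a) x (val (d + r₀))                ≡⟨ defVal-cong (gateDef gs a) x (preds-ready r₀ d input≡x a depth≤d) ⟩
    defVal (gateDef gs a) x (lookup (evalGates gs x))     ≡⟨ sym (evalGates-gateDef gs x a) ⟩
    lookup (evalGates gs x) a ∎
    where open ≡-Reasoning

  preds-ready r₀ zero _ a depth≤0 p p∈ = contradiction (≤-trans (gateDepth-pred gs a p∈) depth≤0) λ ()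
  preds-ready r₀ (suc d) input≡x a depth≤d p p∈ =
    lockstep-eval r₀ d (λ i i≤d → input≡x i (≤-trans i≤d (n≤1+n d))) p
      (s≤s⁻¹ (≤-trans (gateDepth-pred gs a p∈) depth≤d))

-- Acceptance of slowed-down sequences

someAttn-zeros : ∀ {k} (A : Subset k) → someAttn A (replicate k false) ≡ false
someAttn-zeros [] = refl
someAttn-zeros (a ∷ A) = cong₂ _∨_ (Bool.∧-zeroʳ a) (someAttn-zeros A)

someAttn-unwatched : ∀ {k} (x : Vec Bool k) → someAttn (replicate k false) x ≡ false
someAttn-unwatched [] = refl
someAttn-unwatched (b ∷ x) = someAttn-unwatched x

select-unwatched : ∀ {k} (x : Vec Bool k) → select (replicate k false) x ≡ []
select-unwatched [] = refl
select-unwatched (b ∷ x) = select-unwatched x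

someAttn-++-unwatched : ∀ {k X} (A : Subset k) (x : Vec Bool k) (y : Vec Bool X) →
                        someAttn (A ++ replicate X false) (x ++ y) ≡ someAttn A x
someAttn-++-unwatched [] [] y = someAttn-unwatched y
someAttn-++-unwatched (a ∷ A) (b ∷ x) y = cong ((a ∧ b) ∨_) (someAttn-++-unwatched A x y)

select-++-unwatched : ∀ {k X} (P : Subset k) (x : Vec Bool k) (y : Vec Bool X) →
                      select (P ++ replicate X false) (x ++ y) ≡ select P x
select-++-unwatched [] [] y = select-unwatched y
select-++-unwatched (true ∷ P) (b ∷ x) y = cong (b ∷_) (select-++-unwatched P x y)
select-++-unwatched (false ∷ P) (b ∷ x) y = select-++-unwatched P x y

AcceptsAt-cong : ∀ {k k′} (A : Subset k) (A′ : Subset k′) (σ : ℕ → Vec Bool k) (σ′ : ℕ → Vec Bool k′) →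
                 (∀ r → someAttn A (σ r) ≡ someAttn A′ (σ′ r)) → ∀ {t} → AcceptsAt A σ t → AcceptsAt A′ σ′ t
AcceptsAt-cong A A′ σ σ′ same {t} (accept , quiet) =
  subst T (same t) accept , λ j j<t → trans (sym (same j)) (quiet j j<t)

delayed : ∀ {k} → (ℕ → Vec Bool k) → ℕ → Vec Bool k
delayed {k} f zero = replicate k false
delayed f (suc e) = f e

-- τ is f slowed down by the factor p: each state of f is held for p rounds, after
-- p initial rounds of the all-zero state.
module _ {k} (A : Subset k) (p : ℕ) .{{_ : NonZero p}} (f τ : ℕ → Vec Bool k)
         (τ-slowed : ∀ r → τ r ≡ delayed f (r / p)) where

  slowed-at : ∀ t → τ (suc t * p) ≡ f t
  slowed-at t = trans (τ-slowed (suc t * p)) (cong (delayed f) (m*n/n≡m (suc t) p))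

  accepts-slowed : ∀ {t} → AcceptsAt A f t → AcceptsAt A τ (suc t * p)
  accepts-slowed {t} (accept , quiet) = subst (T ∘ someAttn A) (sym (slowed-at t)) accept , quiet-before
    where
    quiet-before : ∀ r → r < suc t * p → someAttn A (τ r) ≡ false
    quiet-before r r< rewrite τ-slowed r with r / p | m<n*o⇒m/o<n {r} {suc t} {p} r<
    ... | zero  | _ = someAttn-zeros A
    ... | suc e | s≤s e<t = quiet e e<t

  accepts-unslowed : ∀ {r} → AcceptsAt A τ r → ∃[ t ] AcceptsAt A f t × τ r ≡ f t
  accepts-unslowed {r} (accept , quiet) with r / p in r/p≡ | τ-slowed r
  ... | zero  | τr≡0 = ⊥-elim (subst T (trans (cong (someAttn A) τr≡0) (someAttn-zeros A)) accept)
  ... | suc t | τr≡ = t , (subst (T ∘ someAttn A) τr≡ accept , quiet-before) , τr≡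
    where
    quiet-before : ∀ j → j < t → someAttn A (f j) ≡ false
    quiet-before j j<t = trans (cong (someAttn A) (sym (slowed-at j))) (quiet (suc j * p) earlier)
      where
      earlier : suc j * p < r
      earlier = <-≤-trans (*-monoˡ-< p (s≤s j<t)) (subst (λ e → e * p ≤ r) r/p≡ (m/n*n≤m r p))

-- The simulating program

≡ᵇ-refl : ∀ n → (n ≡ᵇ n) ≡ true
≡ᵇ-refl zero = refl
≡ᵇ-refl (suc n) = ≡ᵇ-refl n

≢⇒≡ᵇ-false : ∀ m n → m ≢ n → (m ≡ᵇ n) ≡ false
≢⇒≡ᵇ-false zero zero m≢n = contradiction refl m≢n
≢⇒≡ᵇ-false zero (suc n) _ = refl
≢⇒≡ᵇ-false (suc m) zero _ = refl
≢⇒≡ᵇ-false (suc m) (suc n) m≢n = ≢⇒≡ᵇ-false m n (m≢n ∘ cong suc)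

∨-as-if : ∀ b x y → ((b ∧ x) ∨ (not b ∧ y)) ≡ (if b then x else y)
∨-as-if true true y = refl
∨-as-if true false y = refl
∨-as-if false x y = refl

tabulate-const : ∀ {A : Set} n (x : A) → tabulate {n = n} (const x) ≡ replicate n x
tabulate-const n x = trans (tabulate-∘ (const x) (λ i → i)) (map-const _ x)

tabulate-++ : ∀ {A : Set} k X (f : Fin (k + X) → A) → tabulate f ≡ tabulate (f ∘ (_↑ˡ X)) ++ tabulate (f ∘ (k ↑ʳ_))
tabulate-++ zero X f = refl
tabulate-++ (suc k) X f = cong (f zero ∷_) (tabulate-++ k X (f ∘ suc))

replicate-++ : ∀ {A : Set} (x : A) k n → replicate k x ++ replicate n x ≡ replicate (k + n) x
replicate-++ x zero n = refl
replicate-++ x (suc k) n = cong (x ∷_) (replicate-++ x k n)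

concat-replicate : ∀ {A : Set} Δ k (x : A) → concat (replicate Δ (replicate k x)) ≡ replicate (Δ * k) x
concat-replicate zero k x = refl
concat-replicate (suc Δ) k x = trans (cong (replicate k x ++_) (concat-replicate Δ k x)) (replicate-++ x k (Δ * k))

padTo-map-const : ∀ {A B : Set} Δ (z : A) (xs : List B) → padTo Δ z (map (const z) xs) ≡ replicate Δ z
padTo-map-const zero z xs = refl
padTo-map-const {B = B} (suc Δ) z [] = cong (z ∷_) (padTo-map-const {B = B} Δ z [])
padTo-map-const (suc Δ) z (x ∷ xs) = cong (z ∷_) (padTo-map-const Δ z xs)

padTo-nthOr : ∀ {A : Set} Δ (z : A) xs → padTo Δ z xs ≡ tabulate (λ i → nthOr xs (toℕ i) z)
padTo-nthOr zero z xs = refl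
padTo-nthOr (suc Δ) z [] = cong (z ∷_) (padTo-nthOr Δ z [])
padTo-nthOr (suc Δ) z (x ∷ xs) = cong (x ∷_) (padTo-nthOr Δ z xs)

nthOr-map-tabulate : ∀ {B : Set} k (F : B → Fin k → Bool) xs n →
  nthOr (map (tabulate ∘ F) xs) n (replicate k false) ≡ tabulate (λ j → nthOr (map (λ v → F v j) xs) n false)
nthOr-map-tabulate k F [] n = sym (tabulate-const k false)
nthOr-map-tabulate k F (x ∷ xs) zero = refl
nthOr-map-tabulate k F (x ∷ xs) (suc n) = nthOr-map-tabulate k F xs n

module Simulation (isId : ℕ → Bool) (Π : List ℕ) (Δ : ℕ) (D : MPC (length Π) Δ) where
  open MPC D
  open Circuit C using (out) renaming (size to gateCount; gates to gs)

  m : ℕ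
  m = length Π

  inp : ℕ
  inp = m + suc Δ * k

  period : ℕ
  period = suc (suc (depth C))

  -- The heads are the k state bits, one predicate per gate, and the clock positions
  -- 0 … depth + 1, exactly one of which holds in each round.
  H : ℕ
  H = k + (gateCount + period)

  stateVar : Fin k → Fin H
  stateVar j = j ↑ˡ (gateCount + period)

  gateVar : Fin gateCount → Fin H
  gateVar a = k ↑ʳ (a ↑ˡ period)

  clockVar : Fin period → Fin H
  clockVar c = k ↑ʳ (gateCount ↑ʳ c)

  lastTick : Fin period
  lastTick = fromℕ (suc (depth C))

  onHeads : {X : Set} → (Fin k → X) → (Fin gateCount → X) → (Fin period → X) → Fin H → X
  onHeads fs fg fc Y = [ fs , [ fg , fc ]′ ∘ splitAt gateCount ]′ (splitAt k Y)

  module _ {X : Set} (fs : Fin k → X) (fg : Fin gateCount → X) (fc : Fin period → X) where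

    onHeads-stateVar : ∀ j → onHeads fs fg fc (stateVar j) ≡ fs j
    onHeads-stateVar j = cong [ fs , _ ]′ (splitAt-↑ˡ k j _)

    onHeads-gateVar : ∀ a → onHeads fs fg fc (gateVar a) ≡ fg a
    onHeads-gateVar a = trans (cong [ fs , _ ]′ (splitAt-↑ʳ k _ _)) (cong [ fg , fc ]′ (splitAt-↑ˡ gateCount a period))

    onHeads-clockVar : ∀ c → onHeads fs fg fc (clockVar c) ≡ fc c
    onHeads-clockVar c = trans (cong [ fs , _ ]′ (splitAt-↑ʳ k _ _)) (cong [ fg , fc ]′ (splitAt-↑ʳ gateCount period c))

  ids : List (Fin m)
  ids = idPositions isId Π

  neighbourState : Fin Δ → Fin k → Schema m H
  neighbourState i j = atNeighbour ids (bitStrings (length ids)) (toℕ i) (var (stateVar j))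

  inputFormulas : Vec (Schema m H) inp
  inputFormulas = tabulate prop ++ (tabulate (var ∘ stateVar) ++ concat (tabulate (tabulate ∘ neighbourState)))

  allOf : List (Fin gateCount) → Schema m H
  allOf [] = ⊤'
  allOf (p ∷ ps) = var (gateVar p) ∧' allOf ps

  noneOf : List (Fin gateCount) → Schema m H
  noneOf [] = ⊤'
  noneOf (p ∷ ps) = ¬' (var (gateVar p)) ∧' noneOf ps

  gateFormula : GateDef inp gateCount → Schema m H
  gateFormula (input a) = lookup inputFormulas a
  gateFormula (conj ps) = allOf ps
  gateFormula (disj ps) = ¬' (noneOf ps)
  gateFormula (neg p) = ¬' (var (gateVar p))

  stateUpdate : Fin k → Schema m H
  stateUpdate j =
    (var (clockVar lastTick) ∧' var (gateVar (lookup out j))) ∨' (¬' (var (clockVar lastTick)) ∧' var (stateVar j))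

  clockStart : Fin period → Schema m 0
  clockStart zero = ⊤'
  clockStart (suc c) = ⊥'

  clockStep : Fin period → Schema m H
  clockStep zero = var (clockVar lastTick)
  clockStep (suc c) = var (clockVar (inject₁ c))

  program : Program m
  program = record
    { k = H
    ; term = onHeads (const ⊥') (const ⊥') clockStart
    ; iter = onHeads stateUpdate (gateFormula ∘ gateDef gs) clockStep
    ; A = A ++ replicate (gateCount + period) false
    ; P = P ++ replicate (gateCount + period) false
    }

  module _ (M : Kripke m) (hid : HasIdentifiers isId Π M) where

    cfg : ℕ → Fin H → W M → Bool
    cfg r Y w = sat M (iterFormula program r Y) w

    cfg-suc : ∀ r Y w → cfg (suc r) Y w ≡ evalS M (Program.iter program Y) (cfg r) w
    cfg-suc r Y = sat-substS M (Program.iter program Y) (iterFormula program r)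

    cfg-stateVar : ∀ r j w → cfg (suc r) (stateVar j) w ≡ evalS M (stateUpdate j) (cfg r) w
    cfg-stateVar r j w = trans (cfg-suc r _ w) (cong (λ φ → evalS M φ (cfg r) w) (onHeads-stateVar _ _ _ j))

    cfg-gateVar : ∀ r a w → cfg (suc r) (gateVar a) w ≡ evalS M (gateFormula (gateDef gs a)) (cfg r) w
    cfg-gateVar r a w = trans (cfg-suc r _ w) (cong (λ φ → evalS M φ (cfg r) w) (onHeads-gateVar _ _ _ a))

    cfg-clockVar : ∀ r c w → cfg (suc r) (clockVar c) w ≡ evalS M (clockStep c) (cfg r) w
    cfg-clockVar r c w = trans (cfg-suc r _ w) (cong (λ φ → evalS M φ (cfg r) w) (onHeads-clockVar _ _ _ c))

    cfg₀-stateVar : ∀ j w → cfg 0 (stateVar j) w ≡ false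
    cfg₀-stateVar j w = cong (λ φ → sat M φ w) (onHeads-stateVar _ _ _ j)

    cfg₀-clockVar : ∀ c w → cfg 0 (clockVar c) w ≡ sat M (clockStart c) w
    cfg₀-clockVar c w = cong (λ φ → sat M φ w) (onHeads-clockVar _ _ _ c)

    state : ℕ → W M → Vec Bool k
    state r v = tabulate (λ j → cfg r (stateVar j) v)

    circuitInput : (W M → Vec Bool k) → W M → Vec Bool inp
    circuitInput s w =
      localInput M w ++ (s w ++ concat (padTo Δ (replicate k false) (map s (neighbours isId Π M w))))

    circuitInput-cong : ∀ {s s′ : W M → Vec Bool k} → (∀ v → s v ≡ s′ v) → ∀ w → circuitInput s w ≡ circuitInput s′ w
    circuitInput-cong s≡s′ w = cong (localInput M w ++_) (cong₂ _++_ (s≡s′ w)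
      (cong (concat ∘ padTo Δ (replicate k false)) (map-cong s≡s′ (neighbours isId Π M w))))

    evalS-inputFormulas : ∀ ρ w → Vec.map (λ φ → evalS M φ ρ w) inputFormulas ≡
                          circuitInput (λ v → tabulate (λ j → ρ (stateVar j) v)) w
    evalS-inputFormulas ρ w = begin
      ev (tabulate prop ++ (tabulate (var ∘ stateVar) ++ concat (tabulate (tabulate ∘ neighbourState))))
        ≡⟨ trans (map-++ evalˢ (tabulate prop) _)
                 (cong (ev (tabulate prop) ++_) (map-++ evalˢ (tabulate (var ∘ stateVar)) _)) ⟩
      ev (tabulate prop) ++ (ev (tabulate (var ∘ stateVar)) ++ ev (concat (tabulate (tabulate ∘ neighbourState))))
        ≡⟨ cong₂ _++_ (sym (tabulate-∘ evalˢ prop))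
                      (cong₂ _++_ (sym (tabulate-∘ evalˢ (var ∘ stateVar))) neighbour-states) ⟩
      circuitInput st w ∎
      where
      open ≡-Reasoning
      evalˢ : Schema m H → Bool
      evalˢ φ = evalS M φ ρ w
      ev : ∀ {n} → Vec (Schema m H) n → Vec Bool n
      ev = Vec.map evalˢ
      st : W M → Vec Bool k
      st v = tabulate (λ j → ρ (stateVar j) v)
      nbs = neighbours isId Π M w
      concatΔ : Vec (Vec Bool k) Δ → Vec Bool (Δ * k)
      concatΔ = concat
      neighbour-states : ev (concat (tabulate (tabulate ∘ neighbourState))) ≡
                         concatΔ (padTo Δ (replicate k false) (map st nbs))
      neighbour-states = begin
        ev (concat (tabulate (tabulate ∘ neighbourState)))
          ≡⟨ trans (map-concat evalˢ (tabulate (tabulate ∘ neighbourState)))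
                   (cong concatΔ (sym (tabulate-∘ ev (tabulate ∘ neighbourState)))) ⟩
        concatΔ (tabulate (λ i → ev (tabulate (neighbourState i))))
          ≡⟨ cong concatΔ (tabulate-cong λ i → trans (sym (tabulate-∘ evalˢ (neighbourState i)))
               (tabulate-cong λ j → evalS-atNeighbour-bitStrings isId Π M hid (toℕ i) (var (stateVar j)) ρ w)) ⟩
        concatΔ (tabulate (λ i → tabulate (λ j → nthOr (map (ρ (stateVar j)) nbs) (toℕ i) false)))
          ≡⟨ cong concatΔ (tabulate-cong (λ i → sym (nthOr-map-tabulate k (λ v j → ρ (stateVar j) v) nbs (toℕ i)))) ⟩
        concatΔ (tabulate (λ i → nthOr (map st nbs) (toℕ i) (replicate k false)))
          ≡⟨ cong concatΔ (sym (padTo-nthOr Δ _ _)) ⟩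
        concatΔ (padTo Δ (replicate k false) (map st nbs)) ∎

    allOf-correct : ∀ ps ρ w → evalS M (allOf ps) ρ w ≡ all (λ b → ρ (gateVar b) w) ps
    allOf-correct [] ρ w = refl
    allOf-correct (p ∷ ps) ρ w = cong (ρ (gateVar p) w ∧_) (allOf-correct ps ρ w)

    noneOf-correct : ∀ ps ρ w → not (evalS M (noneOf ps) ρ w) ≡ any (λ b → ρ (gateVar b) w) ps
    noneOf-correct [] ρ w = refl
    noneOf-correct (p ∷ ps) ρ w with ρ (gateVar p) w
    ... | true  = refl
    ... | false = noneOf-correct ps ρ w

    evalS-gateFormula : ∀ d ρ w → evalS M (gateFormula d) ρ w ≡
                        defVal d (Vec.map (λ φ → evalS M φ ρ w) inputFormulas) (λ b → ρ (gateVar b) w)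
    evalS-gateFormula (input a) ρ w = sym (lookup-map a _ inputFormulas)
    evalS-gateFormula (conj ps) ρ w = allOf-correct ps ρ w
    evalS-gateFormula (disj ps) ρ w = noneOf-correct ps ρ w
    evalS-gateFormula (neg p) ρ w = refl

    gate-step : ∀ r a w → cfg (suc r) (gateVar a) w ≡
                defVal (gateDef gs a) (circuitInput (state r) w) (λ b → cfg r (gateVar b) w)
    gate-step r a w = trans (cfg-gateVar r a w) (trans (evalS-gateFormula (gateDef gs a) (cfg r) w)
      (cong (λ x → defVal (gateDef gs a) x (λ b → cfg r (gateVar b) w)) (evalS-inputFormulas (cfg r) w)))

    state-step : ∀ r j w → cfg (suc r) (stateVar j) w ≡
      (if cfg r (clockVar lastTick) w then cfg r (gateVar (lookup out j)) w else cfg r (stateVar j) w)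
    state-step r j w = trans (cfg-stateVar r j w)
      (trans (evalS-∨' M (var (clockVar lastTick) ∧' var (gateVar (lookup out j)))
                         (¬' (var (clockVar lastTick)) ∧' var (stateVar j)) (cfg r) w)
             (∨-as-if (cfg r (clockVar lastTick) w) _ _))

    state-step-idle : ∀ r j w → cfg r (clockVar lastTick) w ≡ false → cfg (suc r) (stateVar j) w ≡ cfg r (stateVar j) w
    state-step-idle r j w idle rewrite state-step r j w | idle = refl

    state-step-tick : ∀ r j w → cfg r (clockVar lastTick) w ≡ true →
                      cfg (suc r) (stateVar j) w ≡ cfg r (gateVar (lookup out j)) w
    state-step-tick r j w tick rewrite state-step r j w | tick = refl

    clock-at : ∀ e q → q < period → ∀ c w → cfg (q + e * period) (clockVar c) w ≡ (toℕ c ≡ᵇ q)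
    clock-at zero zero _ zero w = cfg₀-clockVar zero w
    clock-at zero zero _ (suc c) w = cfg₀-clockVar (suc c) w
    clock-at e (suc q) (s≤s q<) zero w = begin
      cfg (suc q + e * period) (clockVar zero) w ≡⟨ cfg-clockVar (q + e * period) zero w ⟩
      cfg (q + e * period) (clockVar lastTick) w ≡⟨ clock-at e q (≤-trans (n≤1+n _) (s≤s q<)) lastTick w ⟩
      (toℕ lastTick ≡ᵇ q)                        ≡⟨ cong (_≡ᵇ q) (toℕ-fromℕ (suc (depth C))) ⟩
      (suc (depth C) ≡ᵇ q)                       ≡⟨ ≢⇒≡ᵇ-false _ q (>⇒≢ q<) ⟩
      false ∎
      where open ≡-Reasoning
    clock-at e (suc q) (s≤s q<) (suc c) w =
      trans (cfg-clockVar (q + e * period) (suc c) w)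
        (trans (clock-at e q (≤-trans (n≤1+n _) (s≤s q<)) (inject₁ c) w) (cong (_≡ᵇ q) (toℕ-inject₁ c)))
    clock-at (suc e) zero _ zero w = begin
      cfg (suc e * period) (clockVar zero) w                 ≡⟨ cfg-clockVar (suc (depth C) + e * period) zero w ⟩
      cfg (suc (depth C) + e * period) (clockVar lastTick) w ≡⟨ clock-at e (suc (depth C)) ≤-refl lastTick w ⟩
      (toℕ lastTick ≡ᵇ suc (depth C))                        ≡⟨ cong (_≡ᵇ suc (depth C)) (toℕ-fromℕ (suc (depth C))) ⟩
      (suc (depth C) ≡ᵇ suc (depth C))                       ≡⟨ ≡ᵇ-refl (depth C) ⟩
      true ∎
      where open ≡-Reasoning
    clock-at (suc e) zero _ (suc c) w = begin
      cfg (suc e * period) (clockVar (suc c)) w                 ≡⟨ cfg-clockVar (suc (depth C) + e * period) (suc c) w ⟩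
      cfg (suc (depth C) + e * period) (clockVar (inject₁ c)) w ≡⟨ clock-at e (suc (depth C)) ≤-refl (inject₁ c) w ⟩
      (toℕ (inject₁ c) ≡ᵇ suc (depth C))                        ≡⟨ cong (_≡ᵇ suc (depth C)) (toℕ-inject₁ c) ⟩
      (toℕ c ≡ᵇ suc (depth C))                                  ≡⟨ ≢⇒≡ᵇ-false _ _ (<⇒≢ (toℕ<n c)) ⟩
      false ∎
      where open ≡-Reasoning

    tick-at : ∀ e q → q < period → ∀ w → cfg (q + e * period) (clockVar lastTick) w ≡ (suc (depth C) ≡ᵇ q)
    tick-at e q q< w = trans (clock-at e q q< lastTick w) (cong (_≡ᵇ q) (toℕ-fromℕ (suc (depth C))))

    mpc : ℕ → W M → Vec Bool k
    mpc t w = mpcState isId Π D M t w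

    run-circuitInput : ∀ e w → run C (circuitInput (λ v → delayed (λ t → mpc t v) e) w) ≡ mpc e w
    run-circuitInput zero w = cong (λ x → run C (localInput M w ++ x)) (begin
      replicate k false ++ concat (padTo Δ (replicate k false) (map (const (replicate k false)) nbs))
        ≡⟨ cong (λ xs → replicate k false ++ concat xs) (padTo-map-const Δ (replicate k false) nbs) ⟩
      replicate k false ++ concat (replicate Δ (replicate k false))
        ≡⟨ cong (replicate k false ++_) (concat-replicate Δ k false) ⟩
      replicate k false ++ replicate (Δ * k) false
        ≡⟨ replicate-++ false k (Δ * k) ⟩
      replicate (suc Δ * k) false ∎)
      where
      open ≡-Reasoning
      nbs = neighbours isId Π M w
    run-circuitInput (suc e) w = refl

    Held : ℕ → Set
    Held e = ∀ q → q < period → ∀ w → state (q + e * period) w ≡ delayed (λ t → mpc t w) e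

    state-frozen : ∀ e q → q < suc (depth C) → ∀ w → state (suc (q + e * period)) w ≡ state (q + e * period) w
    state-frozen e q q< w = tabulate-cong λ j → state-step-idle (q + e * period) j w
      (trans (tick-at e q (≤-trans q< (n≤1+n _)) w) (≢⇒≡ᵇ-false _ q (>⇒≢ q<)))

    held-from-start : ∀ e → (∀ w → state (e * period) w ≡ delayed (λ t → mpc t w) e) → Held e
    held-from-start e start zero _ w = start w
    held-from-start e start (suc q) (s≤s q<) w =
      trans (state-frozen e q q< w) (held-from-start e start q (≤-trans (n≤1+n _) (s≤s q<)) w)

    depth-out : ∀ j → gateDepth gs (lookup out j) ≤ depth C
    depth-out j = subst (_≤ depth C) (lookup-map j (gateDepth gs) out) (foldr-⊔-upper (Vec.map (gateDepth gs) out) j)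

    output-ready : ∀ e → Held e → ∀ w j →
                   cfg (suc (depth C + e * period)) (gateVar (lookup out j)) w ≡ lookup (mpc e w) j
    output-ready e held w j = begin
      cfg (suc (depth C + e * period)) (gateVar (lookup out j)) w
        ≡⟨ lockstep-eval gs x (λ r → circuitInput (state r) w) (λ r b → cfg r (gateVar b) w) (λ r a → gate-step r a w)
             (e * period) (depth C) input-held (lookup out j) (depth-out j) ⟩
      lookup (evalGates gs x) (lookup out j) ≡⟨ sym (lookup-map j _ out) ⟩
      lookup (run C x) j                     ≡⟨ cong (λ v → lookup v j) (run-circuitInput e w) ⟩
      lookup (mpc e w) j ∎
      where
      open ≡-Reasoning
      x = circuitInput (λ v → delayed (λ t → mpc t v) e) w
      input-held : ∀ i → i ≤ depth C → circuitInput (state (i + e * period)) w ≡ x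
      input-held i i≤ = circuitInput-cong (held i (s≤s (≤-trans i≤ (n≤1+n _)))) w

    state-held : ∀ e → Held e
    state-held zero = held-from-start zero λ w → trans (tabulate-cong (λ j → cfg₀-stateVar j w)) (tabulate-const k false)
    state-held (suc e) = held-from-start (suc e) λ w → trans
      (tabulate-cong λ j → trans
        (state-step-tick (suc (depth C) + e * period) j w
          (trans (tick-at e (suc (depth C)) ≤-refl w) (≡ᵇ-refl (depth C))))
        (output-ready e (state-held e) w j))
      (tabulate∘lookup (mpc e w))

    state-slowed : ∀ w r → state r w ≡ delayed (λ t → mpc t w) (r / period)
    state-slowed w r = trans (cong (λ n → state n w) (m≡m%n+[m/n]*n r period))
                             (state-held (r / period) (r % period) (m%n<n r period) w)

    someAttn-configuration : ∀ w r → someAttn (Program.A program) (configuration M program r w) ≡ someAttn A (state r w)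
    someAttn-configuration w r =
      trans (cong (someAttn (Program.A program)) (tabulate-++ k (gateCount + period) (λ Y → cfg r Y w)))
            (someAttn-++-unwatched A (state r w) _)

    select-configuration : ∀ w r → select (Program.P program) (configuration M program r w) ≡ select P (state r w)
    select-configuration w r =
      trans (cong (select (Program.P program)) (tabulate-++ k (gateCount + period) (λ Y → cfg r Y w)))
            (select-++-unwatched P (state r w) _)

    module _ (w : W M) where

      mpc⇒program-accepts : ∀ {t} → MPCAcceptsAt isId Π D M w t → ProgAcceptsAt M program w (suc t * period)
      mpc⇒program-accepts accept =
        AcceptsAt-cong A (Program.A program) (λ r → state r w) (λ r → configuration M program r w)
          (λ r → sym (someAttn-configuration w r))
          (accepts-slowed A period (λ t → mpc t w) (λ r → state r w) (state-slowed w) accept)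

      mpc⇒program-outputs : ∀ {t o} → MPCOutputsAt isId Π D M w t o → ProgOutputsAt M program w (suc t * period) o
      mpc⇒program-outputs {t} (accept , o≡) = mpc⇒program-accepts accept , trans o≡ (sym (begin
        select (Program.P program) (configuration M program (suc t * period) w)
          ≡⟨ select-configuration w (suc t * period) ⟩
        select P (state (suc t * period) w)
          ≡⟨ cong (select P) (slowed-at A period _ _ (state-slowed w) t) ⟩
        select P (mpc t w) ∎))
        where open ≡-Reasoning

      program⇒mpc-outputs : ∀ {r o} → ProgOutputsAt M program w r o → ∃[ t ] MPCOutputsAt isId Π D M w t o
      program⇒mpc-outputs {r} (accept , o≡)
        with accepts-unslowed A period (λ t → mpc t w) (λ r → state r w) (state-slowed w)
               (AcceptsAt-cong (Program.A program) A (λ r → configuration M program r w) (λ r → state r w)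
                  (someAttn-configuration w) accept)
      ... | t , accept′ , state≡ =
        t , accept′ , trans o≡ (trans (select-configuration w r) (cong (select P) state≡))

  program-equivalent : Equivalent isId Π Δ program D
  program-equivalent M (hid , _) w _ =
    (λ (_ , out) → program⇒mpc-outputs M hid w out) ,
    (λ (t , out) → suc t * period , mpc⇒program-outputs M hid w out)

-- Size of the program

sizeS-idFormula : ∀ {m h h′} (ids : List (Fin m)) t → sizeS (idFormula {h = h} ids t) ≡ sizeS (idFormula {h = h′} ids t)
sizeS-idFormula [] [] = refl
sizeS-idFormula [] (_ ∷ _) = refl
sizeS-idFormula (_ ∷ _) [] = refl
sizeS-idFormula {h = h} {h′} (i ∷ ids) (true ∷ t) = cong (λ n → suc (1 + n)) (sizeS-idFormula {h = h} {h′} ids t)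
sizeS-idFormula {h = h} {h′} (i ∷ ids) (false ∷ t) = cong (λ n → suc (2 + n)) (sizeS-idFormula {h = h} {h′} ids t)

module _ {m : ℕ} (ids : List (Fin m)) where

  sizeS-atNeighbour : ∀ {h h′} Ts n (φ : Schema m h) (ψ : Schema m h′) → sizeS φ ≡ sizeS ψ →
                      sizeS (atNeighbour ids Ts n φ) ≡ sizeS (atNeighbour ids Ts n ψ)
  sizeS-atNeighbourFrom : ∀ {h h′} t Ts n (φ : Schema m h) (ψ : Schema m h′) → sizeS φ ≡ sizeS ψ →
                          sizeS (atNeighbourFrom ids t Ts n φ) ≡ sizeS (atNeighbourFrom ids t Ts n ψ)
  sizeS-atNeighbour [] n φ ψ eq = refl
  sizeS-atNeighbour {h} {h′} (t ∷ Ts) n φ ψ eq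
    rewrite sizeS-idFormula {h = h} {h′} ids t | sizeS-atNeighbourFrom t Ts n φ ψ eq | sizeS-atNeighbour Ts n φ ψ eq = refl
  sizeS-atNeighbourFrom {h} {h′} t Ts zero φ ψ eq rewrite sizeS-idFormula {h = h} {h′} ids t | eq = refl
  sizeS-atNeighbourFrom t Ts (suc n) φ ψ eq = sizeS-atNeighbour Ts n φ ψ eq

inputSizeBound : (isId : ℕ → Bool) (Π : List ℕ) (Δ : ℕ) → ℕ
inputSizeBound isId Π Δ = suc (maxList (map neighbourSize (allFin Δ)))
  where
  ids = idPositions isId Π
  neighbourSize : Fin Δ → ℕ
  neighbourSize i = sizeS (atNeighbour ids {h = 1} (bitStrings (length ids)) (toℕ i) (var zero))

-- State and clock heads need at most 15; a gate head at most inputSizeBound + 3 · fan-in + 6.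
headSizeBound : (isId : ℕ → Bool) (Π : List ℕ) (Δ c : ℕ) → ℕ
headSizeBound isId Π Δ c = inputSizeBound isId Π Δ + 3 * c + 15

sum-map-≤ : ∀ {A : Set} (f : A → ℕ) {B} xs → (∀ x → f x ≤ B) → sum (map f xs) ≤ length xs * B
sum-map-≤ f [] bound = z≤n
sum-map-≤ f (x ∷ xs) bound = +-mono-≤ (bound x) (sum-map-≤ f xs bound)

module SimulationSize (isId : ℕ → Bool) (Π : List ℕ) (Δ : ℕ) (D : MPC (length Π) Δ) where
  open MPC D
  open Simulation isId Π Δ D
  open Circuit C using (out) renaming (size to gateCount; gates to gs)

  inputFormula-size : ∀ a → sizeS (lookup inputFormulas a) ≤ inputSizeBound isId Π Δ
  inputFormula-size = VecAll.lookup⁺ small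
    where
    small : VecAll.All (λ φ → sizeS φ ≤ inputSizeBound isId Π Δ) inputFormulas
    small = VecAll.++⁺ (VecAll.tabulate⁺ {f = prop} λ _ → s≤s z≤n)
      (VecAll.++⁺ (VecAll.tabulate⁺ {f = var ∘ stateVar} λ _ → s≤s z≤n)
        (VecAll.concat⁺ (VecAll.tabulate⁺ {f = tabulate ∘ neighbourState} λ i →
          VecAll.tabulate⁺ {f = neighbourState i} λ j →
            subst (_≤ inputSizeBound isId Π Δ)
              (sizeS-atNeighbour ids (bitStrings (length ids)) (toℕ i) (var zero) (var (stateVar j)) refl)
              (≤-trans (maxList-upper (∈-map⁺ _ (∈-allFin i))) (n≤1+n _)))))

  allOf-size : ∀ ps → sizeS (allOf ps) ≤ 3 * length ps + 2
  allOf-size [] = s≤s z≤n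
  allOf-size (p ∷ ps) = ≤-trans (s≤s (s≤s (allOf-size ps))) (≤-trans (n≤1+n _) (≤-reflexive (step (length ps))))
    where
    step : ∀ n → suc (suc (suc (3 * n + 2))) ≡ 3 * suc n + 2
    step = solve-∀

  noneOf-size : ∀ ps → sizeS (noneOf ps) ≤ 3 * length ps + 1
  noneOf-size [] = ≤-refl
  noneOf-size (p ∷ ps) = ≤-trans (s≤s (s≤s (s≤s (noneOf-size ps)))) (≤-reflexive (step (length ps)))
    where
    step : ∀ n → suc (suc (suc (3 * n + 1))) ≡ 3 * suc n + 1
    step = solve-∀

  gateFormula-size : ∀ d → sizeS (gateFormula d) ≤ inputSizeBound isId Π Δ + (3 * length (defPreds d) + 2)
  gateFormula-size (input a) = ≤-trans (inputFormula-size a) (m≤m+n _ _)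
  gateFormula-size (conj ps) = ≤-trans (allOf-size ps) (m≤n+m _ (inputSizeBound isId Π Δ))
  gateFormula-size (disj ps) = ≤-trans (s≤s (noneOf-size ps))
    (≤-trans (≤-reflexive (sym (+-suc (3 * length ps) 1))) (m≤n+m _ (inputSizeBound isId Π Δ)))
  gateFormula-size (neg p) = ≤-trans (m≤n+m 2 3) (m≤n+m 5 (inputSizeBound isId Π Δ))

  module _ (c : ℕ) (fanIn≤c : maxFanIn gs ≤ c) where

    headBound : ℕ
    headBound = headSizeBound isId Π Δ c

    head-size : ∀ Y → 2 + sizeS (Program.term program Y) + sizeS (Program.iter program Y) ≤ headBound
    head-size Y with splitAt k Y
    ... | inj₁ j = m≤n+m 15 (inputSizeBound isId Π Δ + 3 * c)
    ... | inj₂ Z with splitAt gateCount Z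
    ...   | inj₁ a = gate-bound (gateFormula-size (gateDef gs a)) (≤-trans (fanIn-gateDef gs a) fanIn≤c)
      where
      gate-bound : ∀ {s l} → s ≤ inputSizeBound isId Π Δ + (3 * l + 2) → l ≤ c → 2 + 2 + s ≤ headBound
      gate-bound {s} {l} s≤ l≤c = ≤-trans (+-monoʳ-≤ 4 s≤) (≤-trans (≤-reflexive (shuffle (inputSizeBound isId Π Δ) l))
        (+-mono-≤ (+-monoʳ-≤ (inputSizeBound isId Π Δ) (*-monoʳ-≤ 3 l≤c)) (m≤n+m 6 9)))
        where
        shuffle : ∀ a b → 4 + (a + (3 * b + 2)) ≡ a + 3 * b + 6
        shuffle = solve-∀
    ...   | inj₂ zero = ≤-trans (m≤n+m 4 11) (m≤n+m 15 (inputSizeBound isId Π Δ + 3 * c))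
    ...   | inj₂ (suc _) = ≤-trans (m≤n+m 5 10) (m≤n+m 15 (inputSizeBound isId Π Δ + 3 * c))

    programSize-≤ : programSize program ≤ H * headBound
    programSize-≤ = subst (λ n → programSize program ≤ n * headBound) (length-tabulate {n = H} (λ i → i))
      (sum-map-≤ _ (allFin H) head-size)

    module _ (wf : WellFormed C) (gateCount≥1 : 1 ≤ gateCount) where

      heads-≤ : H ≤ 5 * gateCount
      heads-≤ = ≤-trans (+-mono-≤ k≤ (+-monoʳ-≤ gateCount (s≤s (s≤s depth≤))))
        (≤-trans (≤-reflexive (e₁ gateCount)) (≤-trans (+-monoʳ-≤ (3 * gateCount) (+-mono-≤ gateCount≥1 gateCount≥1))
          (≤-reflexive (e₂ gateCount))))
        where
        k≤ : k ≤ gateCount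
        k≤ = injective⇒≤ (proj₁ wf)
        depth≤ : depth C ≤ gateCount
        depth≤ = foldr-⊔-least (Vec.map (gateDepth gs) out) λ i →
          subst (_≤ gateCount) (sym (lookup-map i (gateDepth gs) out)) (gateDepth-≤-size gs (lookup out i))
        e₁ : ∀ s → s + (s + suc (suc s)) ≡ 3 * s + (1 + 1)
        e₁ = solve-∀
        e₂ : ∀ s → 3 * s + (s + s) ≡ 5 * s
        e₂ = solve-∀

      programSize-linear : programSize program ≤ 5 * headBound * gateCount
      programSize-linear =
        ≤-trans programSize-≤ (≤-trans (*-monoˡ-≤ headBound heads-≤) (≤-reflexive (e gateCount headBound)))
        where
        e : ∀ s b → 5 * s * b ≡ 5 * b * s
        e = solve-∀

emptyProgram : ∀ {m} → Program m
emptyProgram = record { k = 0 ; term = λ () ; iter = λ () ; A = [] ; P = [] }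

never-accepts₀ : ∀ {k} → k ≡ 0 → (A : Subset k) (s : ℕ → Vec Bool k) (t : ℕ) → ¬ AcceptsAt A s t
never-accepts₀ refl [] s t (accept , _) = subst T (nothing-watched (s t)) accept
  where
  nothing-watched : (v : Vec Bool 0) → someAttn [] v ≡ false
  nothing-watched [] = refl

-- The 2 ^ n term is slack: neighbours are addressed within a single round.
slowdown-≤ : ∀ d n t → suc t * suc (suc d) ≤ 2 * (d + 2 ^ n) * suc t
slowdown-≤ d n t = ≤-trans (*-monoʳ-≤ (suc t) period≤) (≤-reflexive (*-comm (suc t) _))
  where
  period≤ : suc (suc d) ≤ 2 * (d + 2 ^ n)
  period≤ = ≤-trans (+-monoʳ-≤ 2 (m≤m+n d d)) (≤-trans (≤-reflexive (e d)) (*-monoʳ-≤ 2 (+-monoʳ-≤ d (m^n>0 2 n))))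
    where
    e : ∀ d → 2 + (d + d) ≡ 2 * (d + 1)
    e = solve-∀

-- An MPC with state length 0 never accepts; its circuit may have no gates at all, so that
-- only the empty program meets the size bound.
module Translation (isId : ℕ → Bool) (Π : List ℕ) (Δ : ℕ) where

  unlessStateless : ℕ → Program (length Π) → Program (length Π)
  unlessStateless zero _ = emptyProgram
  unlessStateless (suc _) Pr = Pr

  translate : MPC (length Π) Δ → Program (length Π)
  translate D = unlessStateless (MPC.k D) (Simulation.program isId Π Δ D)

  module _ (D : MPC (length Π) Δ) where
    open MPC D
    open Simulation isId Π Δ D using (program; program-equivalent; mpc⇒program-accepts; period)

    translate-equivalent : Equivalent isId Π Δ (translate D) D
    translate-equivalent = go k refl
      where
      go : ∀ n → n ≡ k → Equivalent isId Π Δ (unlessStateless n program) D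
      go zero k≡0 M _ w _ =
        (λ (t , accept , _) → ⊥-elim (never-accepts₀ refl [] (λ r → configuration M emptyProgram r w) t accept)) ,
        (λ (t , accept , _) → ⊥-elim (never-accepts₀ (sym k≡0) A (λ r → mpcState isId Π D M r w) t accept))
      go (suc _) _ = program-equivalent

    translate-time : ∀ M → InClass isId Π M Δ → ∀ w t → MPCAcceptsAt isId Π D M w t →
                     ∃[ t′ ] (ProgAcceptsAt M (translate D) w t′ × t′ ≤ 2 * (depth C + 2 ^ numIds isId Π) * suc t)
    translate-time M (hid , _) w t accept = go k refl
      where
      go : ∀ n → n ≡ k →
           ∃[ t′ ] (ProgAcceptsAt M (unlessStateless n program) w t′ × t′ ≤ 2 * (depth C + 2 ^ numIds isId Π) * suc t)
      go zero k≡0 = ⊥-elim (never-accepts₀ (sym k≡0) A (λ r → mpcState isId Π D M r w) t accept)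
      go (suc _) _ = suc t * period , mpc⇒program-accepts M hid w accept , slowdown-≤ (depth C) (numIds isId Π) t

    translate-size : ∀ c → WellFormed C → maxFanIn (Circuit.gates C) ≤ c →
                     programSize (translate D) ≤ 5 * headSizeBound isId Π Δ c * Circuit.size C
    translate-size c wf fanIn≤c = go k refl
      where
      go : ∀ n → n ≡ k → programSize (unlessStateless n program) ≤ 5 * headSizeBound isId Π Δ c * Circuit.size C
      go zero _ = z≤n
      go (suc _) sn≡k = SimulationSize.programSize-linear isId Π Δ D c fanIn≤c wf
                          (has-gate (lookup (Circuit.out C) (subst Fin sn≡k zero)))
        where
        has-gate : ∀ {n} → Fin n → 1 ≤ n
        has-gate {suc _} _ = s≤s z≤n

theorem5 : ∃[ K′ ] ((isId : ℕ → Bool) (Π : List ℕ) → Linked _<_ Π → (Δ : ℕ) →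
    Σ (MPC (length Π) Δ → Program (length Π)) λ F →
      ((D : MPC (length Π) Δ) → WellFormed (MPC.C D) →
          Equivalent isId Π Δ (F D) D
        × ((M : Kripke (length Π)) → InClass isId Π M Δ → (w : W M) → (t : ℕ) →
            MPCAcceptsAt isId Π D M w t →
            ∃[ t′ ] (ProgAcceptsAt M (F D) w t′
              × t′ ≤ K′ * (depth (MPC.C D) + 2 ^ numIds isId Π) * suc t)))
    × ((c : ℕ) → ∃[ K ] ((D : MPC (length Π) Δ) → WellFormed (MPC.C D) →
          maxFanIn (Circuit.gates (MPC.C D)) ≤ c →
          programSize (F D) ≤ K * Circuit.size (MPC.C D))))
theorem5 = 2 , λ isId Π _ Δ → let open Translation isId Π Δ in
  translate ,
  (λ D _ → translate-equivalent D , translate-time D) ,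
  (λ c → 5 * headSizeBound isId Π Δ c , λ D wf fanIn≤c → translate-size D c wf fanIn≤c)
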